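{- Let $\mathcal M$ be a regular linear hypermap. Then the associated map $M$ of $\mathcal M$ is a 2-orbit arc-transitive map.
   Context: A linear hypermap is a 2-cell embedding of an associated graph $\Gamma$ of a connected linear hypergraph $\mathcal H=(V,X)$ (linear: two distinct vertices lie in at most one hyperedge; associated graph: for each $x\in X$ the induced subgraph $\Gamma[x]$ is a cycle, possibly a 2-cycle of parallel edges, and each edge of $\Gamma$ lies in a unique hyperedge) in a closed surface, such that each $\Gamma[x]$ bounds a 2-cell (a hyperedge), each edge of $\Gamma$ is incident with exactly two distinct 2-cells, and the other 2-cells are hyperfaces; standing assumption: more than one hyperedge and no hyperedge of size 1. Flags of $\mathcal M$ are the arcs of $\Gamma$, and the flag involutions are $r_0$ (reverse the arc), $r_1$ (same vertex and hyperface, other edge at that corner), $r_2$ (same vertex and hyperedge, other edge of the hyperedge boundary at that vertex). An automorphism of $\mathcal M$ is a permutation of the flags commuting with $r_0,r_1,r_2$ (equivalently, an incidence-preserving permutation of vertices, hyperedges and hyperfaces); $\mathcal M$ is regular if its automorphism group is transitive on flags. The associated map $M$ of $\mathcal M$ is the map on the same surface given by the embedding of $\Gamma$, whose faces are all hyperedges and hyperfaces. A map is 2-orbit if its automorphism group contains a subgroup with exactly two orbits on the flags (vertex-edge-face incident triples) of the map, and arc-transitive if its automorphism group is transitive on the arcs of its underlying graph. -}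

module Defs where

open import Data.Nat using (ℕ)
open import Data.Fin using (Fin)
open import Data.Bool using (Bool; true; false; not)
open import Data.Product using (Σ; ∃; ∃-syntax; _×_; _,_; proj₁; proj₂)
open import Data.Sum using (_⊎_)
open import Relation.Binary.PropositionalEquality using (_≡_; _≢_)
open import Relation.Nullary using (¬_)

-- Orbits of subgroups generated by two / three permutations of a set.
-- (All permutations used below are involutions, so the reflexive-
-- transitive closure of forward steps is the orbit relation.)

data Orbit₂ {A : Set} (f g : A → A) (a : A) : A → Set where
  here  : Orbit₂ f g a a
  stepf : ∀ {b} → Orbit₂ f g a b → Orbit₂ f g a (f b)
  stepg : ∀ {b} → Orbit₂ f g a b → Orbit₂ f g a (g b)

data Orbit₃ {A : Set} (f g h : A → A) (a : A) : A → Set where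
  here  : Orbit₃ f g h a a
  stepf : ∀ {b} → Orbit₃ f g h a b → Orbit₃ f g h a (f b)
  stepg : ∀ {b} → Orbit₃ f g h a b → Orbit₃ f g h a (g b)
  steph : ∀ {b} → Orbit₃ f g h a b → Orbit₃ f g h a (h b)

-- Combinatorial data of a hypermap whose flags are the arcs of the
-- associated graph Γ: finitely many flags and the involutions r₀ r₁ r₂.

record HypermapData : Set where
  field
    nflags : ℕ
    r₀ r₁ r₂ : Fin nflags → Fin nflags

  Flag : Set
  Flag = Fin nflags

  SameVertex : Flag → Flag → Set
  SameVertex = Orbit₂ r₁ r₂

  SameHyperedge : Flag → Flag → Set
  SameHyperedge = Orbit₂ r₀ r₂

  SameHyperface : Flag → Flag → Set
  SameHyperface = Orbit₂ r₀ r₁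

open HypermapData public using (nflags; r₀; r₁; r₂; Flag)

-- Conditions making the data a linear hypermap (standing assumptions
-- included: more than one hyperedge, no hyperedge of size 1).
record IsLinearHypermap (H : HypermapData) : Set where
  open HypermapData H renaming (r₀ to s₀; r₁ to s₁; r₂ to s₂)
  field
    inv₀ : ∀ a → s₀ (s₀ a) ≡ a
    inv₁ : ∀ a → s₁ (s₁ a) ≡ a
    inv₂ : ∀ a → s₂ (s₂ a) ≡ a
    fpf₀ : ∀ a → s₀ a ≢ a
    fpf₁ : ∀ a → s₁ a ≢ a
    fpf₂ : ∀ a → s₂ a ≢ a
    connected : ∀ a b → Orbit₃ s₀ s₁ s₂ a b
    -- the boundary of each hyperedge is a cycle Γ[x]: it passes through
    -- each of its vertices exactly once (with its two edges there)
    hyperedgeCycle : ∀ a b → SameHyperedge a b → SameVertex a b →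
                     (b ≡ a) ⊎ (b ≡ s₂ a)
    -- linearity: two distinct vertices lie in at most one hyperedge
    linear : ∀ a b c d →
             SameHyperedge a b → SameHyperedge c d →
             SameVertex a c → SameVertex b d → ¬ SameVertex a b →
             SameHyperedge a c
    hyperedgeSize : ∀ a → ∃[ b ] (SameHyperedge a b × ¬ SameVertex a b)
    twoHyperedges : ∃[ a ] ∃[ b ] ¬ SameHyperedge a b

record Aut {A : Set} (s₀ s₁ s₂ : A → A) : Set where
  field
    fun : A → A
    inv : A → A
    inv-fun : ∀ x → inv (fun x) ≡ x
    fun-inv : ∀ x → fun (inv x) ≡ x
    comm₀ : ∀ x → fun (s₀ x) ≡ s₀ (fun x)
    comm₁ : ∀ x → fun (s₁ x) ≡ s₁ (fun x)
    comm₂ : ∀ x → fun (s₂ x) ≡ s₂ (fun x)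

open Aut public

record IsSubgroup {A : Set} {s₀ s₁ s₂ : A → A}
                  (P : Aut s₀ s₁ s₂ → Set) : Set where
  field
    respects : ∀ φ ψ → (∀ x → fun φ x ≡ fun ψ x) → P φ → P ψ
    hasId : ∃[ φ ] (P φ × (∀ x → fun φ x ≡ x))
    closedComp : ∀ φ ψ → P φ → P ψ →
                 ∃[ χ ] (P χ × (∀ x → fun χ x ≡ fun φ (fun ψ x)))
    closedInv : ∀ φ → P φ → ∃[ χ ] (P χ × (∀ x → fun χ x ≡ inv φ x))

IsRegularHypermap : HypermapData → Set
IsRegularHypermap H =
  ∀ a b → ∃[ φ ] (fun {s₀ = r₀ H} {r₁ H} {r₂ H} φ a ≡ b)

-- The associated map M: same embedded graph Γ, faces = hyperedges and
-- hyperfaces.  A flag of M (vertex, edge, face) is an arc a of Γ (giving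
-- vertex and edge) together with one of the two faces at that edge:
-- true = the hyperedge, false = the hyperface.

MapFlag : HypermapData → Set
MapFlag H = Flag H × Bool

-- ρ₀ : change vertex;  ρ₁ : change edge;  ρ₂ : change face.
ρ₀ : (H : HypermapData) → MapFlag H → MapFlag H
ρ₀ H (a , s) = (r₀ H a , s)

ρ₁ : (H : HypermapData) → MapFlag H → MapFlag H
ρ₁ H (a , true)  = (r₂ H a , true)
ρ₁ H (a , false) = (r₁ H a , false)

ρ₂ : (H : HypermapData) → MapFlag H → MapFlag H
ρ₂ H (a , s) = (a , not s)

MapAut : HypermapData → Set
MapAut H = Aut (ρ₀ H) (ρ₁ H) (ρ₂ H)

arcOf : (H : HypermapData) → MapFlag H → Flag H
arcOf H (a , s) = a

IsTwoOrbitMap : HypermapData → Set₁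
IsTwoOrbitMap H =
  Σ (MapAut H → Set) λ P →
    IsSubgroup P ×
    (∃[ x ] ∃[ y ]
      ( ¬ (∃[ ψ ] (P ψ × fun ψ x ≡ y))
      × (∀ z → (∃[ ψ ] (P ψ × fun ψ x ≡ z)) ⊎ (∃[ ψ ] (P ψ × fun ψ y ≡ z)))))

IsArcTransitiveMap : HypermapData → Set
IsArcTransitiveMap H =
  ∀ a b → ∃[ ψ ] (∀ s → arcOf H (fun {s₀ = ρ₀ H} {ρ₁ H} {ρ₂ H} ψ (a , s)) ≡ b)

-- Every automorphism of the hypermap acts on the flags (a , s) of the
-- associated map through the arc a, leaving the face type s (hyperedge or
-- hyperface) untouched.  These lifts form a subgroup of Aut(M) preserving the
-- face type; regularity makes it transitive on each face type, so it has
-- exactly two orbits on flags, and it is transitive on arcs.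
module Submission where

open import Defs
open import Data.Bool using (Bool; true; false)
open import Data.Product using (_×_; ∃-syntax; _,_; proj₁; proj₂)
open import Data.Sum using (inj₁; inj₂)
open import Relation.Nullary using (¬_)
open import Relation.Binary.PropositionalEquality
  using (_≡_; refl; sym; trans; cong; module ≡-Reasoning)

module _ {A : Set} {s₀ s₁ s₂ : A → A} where

  Aut-id : Aut s₀ s₁ s₂
  Aut-id = record
    { fun = λ x → x ; inv = λ x → x
    ; inv-fun = λ _ → refl ; fun-inv = λ _ → refl
    ; comm₀ = λ _ → refl ; comm₁ = λ _ → refl ; comm₂ = λ _ → refl
    }

  Aut-compose : Aut s₀ s₁ s₂ → Aut s₀ s₁ s₂ → Aut s₀ s₁ s₂
  Aut-compose φ ψ = record
    { fun = λ x → fun φ (fun ψ x)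
    ; inv = λ x → inv ψ (inv φ x)
    ; inv-fun = λ x → trans (cong (inv ψ) (inv-fun φ (fun ψ x))) (inv-fun ψ x)
    ; fun-inv = λ x → trans (cong (fun φ) (fun-inv ψ (inv φ x))) (fun-inv φ x)
    ; comm₀ = λ x → trans (cong (fun φ) (comm₀ ψ x)) (comm₀ φ (fun ψ x))
    ; comm₁ = λ x → trans (cong (fun φ) (comm₁ ψ x)) (comm₁ φ (fun ψ x))
    ; comm₂ = λ x → trans (cong (fun φ) (comm₂ ψ x)) (comm₂ φ (fun ψ x))
    }

  inv-comm : (ψ : Aut s₀ s₁ s₂) (s : A → A) →
             (∀ x → fun ψ (s x) ≡ s (fun ψ x)) → ∀ x → inv ψ (s x) ≡ s (inv ψ x)
  inv-comm ψ s fun-comm x = begin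
    inv ψ (s x)                   ≡⟨ cong (λ y → inv ψ (s y)) (sym (fun-inv ψ x)) ⟩
    inv ψ (s (fun ψ (inv ψ x)))   ≡⟨ cong (inv ψ) (sym (fun-comm (inv ψ x))) ⟩
    inv ψ (fun ψ (s (inv ψ x)))   ≡⟨ inv-fun ψ (s (inv ψ x)) ⟩
    s (inv ψ x)                   ∎
    where open ≡-Reasoning

  Aut-inverse : Aut s₀ s₁ s₂ → Aut s₀ s₁ s₂
  Aut-inverse ψ = record
    { fun = inv ψ ; inv = fun ψ ; inv-fun = fun-inv ψ ; fun-inv = inv-fun ψ
    ; comm₀ = inv-comm ψ s₀ (comm₀ ψ)
    ; comm₁ = inv-comm ψ s₁ (comm₁ ψ)
    ; comm₂ = inv-comm ψ s₂ (comm₂ ψ)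
    }

  Preserves : {B : Set} → (A → B) → Aut s₀ s₁ s₂ → Set
  Preserves colour ψ = ∀ x → colour (fun ψ x) ≡ colour x

  preserves-isSubgroup : {B : Set} (colour : A → B) → IsSubgroup (Preserves colour)
  preserves-isSubgroup colour = record
    { respects = λ φ ψ φ≗ψ φ-pres x → trans (cong colour (sym (φ≗ψ x))) (φ-pres x)
    ; hasId = Aut-id , (λ _ → refl) , (λ _ → refl)
    ; closedComp = λ φ ψ φ-pres ψ-pres →
        Aut-compose φ ψ , (λ x → trans (φ-pres (fun ψ x)) (ψ-pres x)) , (λ _ → refl)
    ; closedInv = λ ψ ψ-pres →
        Aut-inverse ψ ,
        (λ x → trans (sym (ψ-pres (inv ψ x))) (cong colour (fun-inv ψ x))) ,
        (λ _ → refl)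
    }

  preserves-separates : {B : Set} {colour : A → B} {ψ : Aut s₀ s₁ s₂} {x y : A} →
                        Preserves colour ψ → ¬ colour x ≡ colour y → ¬ fun ψ x ≡ y
  preserves-separates {colour = colour} {x = x} ψ-pres x≉y ψx≡y =
    x≉y (trans (sym (ψ-pres x)) (cong colour ψx≡y))

module _ (H : HypermapData) where

  faceType : MapFlag H → Bool
  faceType = proj₂

  liftAut : Aut (r₀ H) (r₁ H) (r₂ H) → MapAut H
  liftAut φ = record
    { fun = λ { (a , s) → fun φ a , s }
    ; inv = λ { (a , s) → inv φ a , s }
    ; inv-fun = λ { (a , s) → cong (_, s) (inv-fun φ a) }
    ; fun-inv = λ { (a , s) → cong (_, s) (fun-inv φ a) }
    ; comm₀ = λ { (a , s) → cong (_, s) (comm₀ φ a) }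
    ; comm₁ = λ { (a , true) → cong (_, true) (comm₂ φ a)
                ; (a , false) → cong (_, false) (comm₁ φ a) }
    ; comm₂ = λ _ → refl
    }

  liftAut-preserves : ∀ φ → Preserves faceType (liftAut φ)
  liftAut-preserves φ _ = refl

  liftAut-transitive : IsRegularHypermap H → ∀ a b s →
                       ∃[ ψ ] (Preserves faceType ψ × fun ψ (a , s) ≡ (b , s))
  liftAut-transitive regular a b s =
    let φ , φa≡b = regular a b in
    liftAut φ , liftAut-preserves φ , cong (_, s) φa≡b

proposition4p3 : (H : HypermapData) → IsLinearHypermap H → IsRegularHypermap H →
    IsTwoOrbitMap H × IsArcTransitiveMap H
proposition4p3 H linear regular = twoOrbit , arcTransitive
  where
  -- Any flag will do; the hypermap axioms are only used to know that one exists.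
  a₀ : Flag H
  a₀ = proj₁ (IsLinearHypermap.twoHyperedges linear)

  twoOrbit : IsTwoOrbitMap H
  twoOrbit =
    Preserves (faceType H) , preserves-isSubgroup (faceType H) ,
    (a₀ , true) , (a₀ , false) ,
    (λ { (ψ , ψ-pres , ψx≡y) → preserves-separates {ψ = ψ} ψ-pres (λ ()) ψx≡y }) ,
    λ { (b , true)  → inj₁ (liftAut-transitive H regular a₀ b true)
      ; (b , false) → inj₂ (liftAut-transitive H regular a₀ b false) }

  arcTransitive : IsArcTransitiveMap H
  arcTransitive a b = liftAut H (proj₁ (regular a b)) , λ _ → proj₂ (regular a b)
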